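{- Let $w$ be a non-empty finite word over $\mathcal{A}=\{a,b\}$ ordered by $a<b$. Then $w$ is not balanced (equivalently, not finite Sturmian) if and only if there exists a finite word $u$ such that $aua$ is a prefix of $\min(w)$ and $bub$ is a prefix of $\max(w)$.
   Context: A word $w$ over $\{a,b\}$ is balanced if for any factors $u,v$ of $w$ with $|u|=|v|$ one has $\big||u|_b-|v|_b\big|\le1$; finite balanced words are exactly the factors of Sturmian words. Words are ordered lexicographically with $a<b$. For $k\le|w|$, $\min(w|k)$ (resp. $\max(w|k)$) is the lexicographically smallest (resp. greatest) factor of $w$ of length $k$; $\min(w)$ is $\min(w|k)$ for the maximal $k$ such that all $\min(w|j)$, $j=1,\dots,k$, are prefixes of $\min(w|k)$, and $\max(w)$ is defined analogously with $\max$. -}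

module Defs where

open import Data.Nat using (ℕ; zero; suc; _≤_; _<_)
open import Data.List using (List; []; _∷_; _++_; length)
open import Data.Product using (Σ; ∃; _×_; _,_)
open import Data.Sum using (_⊎_)
open import Relation.Binary.PropositionalEquality using (_≡_)
open import Relation.Nullary using (¬_)

data Letter : Set where
  a b : Letter

Word : Set
Word = List Letter

count-b : Word → ℕ
count-b []       = 0
count-b (a ∷ w)  = count-b w
count-b (b ∷ w)  = suc (count-b w)

Factor : Word → Word → Set
Factor u w = ∃ λ x → ∃ λ y → x ++ (u ++ y) ≡ w

Prefix : Word → Word → Set
Prefix p w = ∃ λ s → p ++ s ≡ w

Balanced : Word → Set
Balanced w = ∀ u v → Factor u w → Factor v w → length u ≡ length v →
             count-b u ≤ suc (count-b v)

data _<lex_ : Word → Word → Set where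
  []<∷  : ∀ {x xs} → [] <lex (x ∷ xs)
  a<b   : ∀ {xs ys} → (a ∷ xs) <lex (b ∷ ys)
  ∷<∷   : ∀ {x xs ys} → xs <lex ys → (x ∷ xs) <lex (x ∷ ys)

_≤lex_ : Word → Word → Set
u ≤lex v = u ≡ v ⊎ u <lex v

IsMinK : Word → ℕ → Word → Set
IsMinK w k m = Factor m w × length m ≡ k × (∀ v → Factor v w → length v ≡ k → m ≤lex v)

IsMaxK : Word → ℕ → Word → Set
IsMaxK w k m = Factor m w × length m ≡ k × (∀ v → Factor v w → length v ≡ k → v ≤lex m)

MinChain : Word → ℕ → Word → Set
MinChain w k m = k ≤ length w × IsMinK w k m ×
  (∀ j m' → 1 ≤ j → j ≤ k → IsMinK w j m' → Prefix m' m)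

MaxChain : Word → ℕ → Word → Set
MaxChain w k m = k ≤ length w × IsMaxK w k m ×
  (∀ j m' → 1 ≤ j → j ≤ k → IsMaxK w j m' → Prefix m' m)

IsMin : Word → Word → Set
IsMin w m = ∃ λ k → MinChain w k m ×
  (∀ k' m' → k < k' → ¬ MinChain w k' m')

IsMax : Word → Word → Set
IsMax w m = ∃ λ k → MaxChain w k m ×
  (∀ k' m' → k < k' → ¬ MaxChain w k' m')

module Submission where

-- Call u an obstruction in w when both a·u·a and b·u·b are factors of w.
--
-- (1) Balance.  w is unbalanced iff it has an obstruction (Lothaire, Prop. 2.1.3).
--     An obstruction gives two factors of equal length whose b-counts differ by 2.
--     Conversely, given equal-length factors x, y with |x|_b ≥ |y|_b + 2, we walk
--     along them; where x reads b and y reads a we follow the common continuation p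
--     until the words diverge: either b·p·b and a·p·a occur (an obstruction), or the
--     remaining suffixes are again a pair with imbalance ≥ 2, and we recurse.
-- (2) Minimal obstructions.  If u is an obstruction of minimal length, every prefix
--     of a·u·a is the least factor of its length, since a smaller factor would expose
--     a shorter obstruction at the position where the two words first differ; dually
--     every prefix of b·u·b is the greatest factor of its length.  Hence a·u·a and
--     b·u·b satisfy the prefix-chain condition, so they are prefixes of min(w), max(w).
-- The theorem follows: a witness u for min(w), max(w) is an obstruction; if there is
-- no witness (a decidable property), there is no minimal obstruction, hence none at all,
-- and w is balanced by (1).

open import Defs
open import Data.List using ([]; _∷_; _++_; length; take; drop)
open import Data.List.Properties
  using (++-assoc; ++-identityʳ; ∷-injective; ∷-injectiveʳ; length-++; length-++-≤ˡ; length-++-≤ʳ; length-take; take++drop≡id)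
open import Data.Product using (∃; _×_; _,_)
open import Data.Sum using (_⊎_; inj₁; inj₂)
open import Data.Empty using (⊥-elim)
open import Data.Nat using (suc; _+_; _≤_; _<_; z≤n; s≤s; _≤?_; _<?_)
open import Data.Nat.Properties using (≤-trans; <⇒≤; ≰⇒>; ≮⇒≥; m<m+n; <-irrefl; suc-injective; m≤n⇒m⊓n≡m)
open import Data.Nat.Induction using (<-wellFounded)
open import Induction.WellFounded using (Acc; acc)
open import Relation.Binary.Construct.On as On using ()
open import Relation.Binary.PropositionalEquality using (_≡_; _≢_; refl; sym; trans; cong; subst)
open import Relation.Nullary using (¬_; Dec; yes; no)
open import Relation.Nullary.Decidable using (map′)
open import Function.Base using (_on_)
open import Function.Bundles using (_⇔_; mk⇔)

prefix-factor : ∀ {p v w} → Prefix p v → Factor v w → Factor p w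
prefix-factor {p} (s , refl) (x , y , eq) =
  x , s ++ y , trans (cong (x ++_) (sym (++-assoc p s y))) eq

suffix-factor : ∀ q {s w} → Factor (q ++ s) w → Factor s w
suffix-factor q {s} (x , y , eq) =
  x ++ q , y , trans (++-assoc x q (s ++ y)) (trans (cong (x ++_) (sym (++-assoc q s y))) eq)

factor-length : ∀ {v w} → Factor v w → length v ≤ length w
factor-length {v} (x , y , refl) = ≤-trans (length-++-≤ˡ v) (length-++-≤ʳ (v ++ y) {x})

prefix-++ʳ : ∀ {p v} r → Prefix p v → Prefix p (v ++ r)
prefix-++ʳ {p} r (s , refl) = s ++ r , sym (++-assoc p s r)

prefix-of-length : ∀ j (m : Word) → j ≤ length m → ∃ λ y → Prefix y m × length y ≡ j
prefix-of-length j m j≤ =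
  take j m , (drop j m , take++drop≡id j m) , trans (length-take j m) (m≤n⇒m⊓n≡m j≤)

marked-prefix : ∀ x q c t → Prefix (x ∷ q ++ c ∷ []) (x ∷ q ++ c ∷ t)
marked-prefix x q c t = t , cong (x ∷_) (++-assoc q (c ∷ []) t)

marked-shorter : ∀ (q : Word) c s → length q < length (q ++ c ∷ s)
marked-shorter q c s = subst (length q <_) (sym (length-++ q)) (m<m+n (length q) (s≤s z≤n))

split-before-last : ∀ q u {c d s} → c ≢ d → q ++ c ∷ s ≡ u ++ d ∷ [] → ∃ λ (s' : Word) → u ≡ q ++ c ∷ s'
split-before-last []          []      c≢d refl = ⊥-elim (c≢d refl)
split-before-last []          (x ∷ u) _   refl = u , refl
split-before-last (_ ∷ [])    []      _   ()
split-before-last (_ ∷ _ ∷ _) []      _   ()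
split-before-last (x ∷ q)     (y ∷ u) c≢d e with ∷-injective e
... | refl , e′ with split-before-last q u c≢d e′
...   | s' , refl = s' , refl

Comparison : Word → Word → Set
Comparison v y = v ≡ y ⊎ v <lex y ⊎ y <lex v

compare-cons : ∀ x {v y} → Comparison v y → Comparison (x ∷ v) (x ∷ y)
compare-cons x (inj₁ refl)       = inj₁ refl
compare-cons x (inj₂ (inj₁ v<y)) = inj₂ (inj₁ (∷<∷ v<y))
compare-cons x (inj₂ (inj₂ y<v)) = inj₂ (inj₂ (∷<∷ y<v))

lex-trichotomy : ∀ v y → length v ≡ length y → Comparison v y
lex-trichotomy []      []      _ = inj₁ refl
lex-trichotomy (a ∷ _) (b ∷ _) _ = inj₂ (inj₁ a<b)
lex-trichotomy (b ∷ _) (a ∷ _) _ = inj₂ (inj₂ a<b)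
lex-trichotomy (a ∷ v) (a ∷ y) e = compare-cons a (lex-trichotomy v y (suc-injective e))
lex-trichotomy (b ∷ v) (b ∷ y) e = compare-cons b (lex-trichotomy v y (suc-injective e))

lex-asym : ∀ {u v} → u <lex v → ¬ v <lex u
lex-asym (∷<∷ u<v) (∷<∷ v<u) = lex-asym u<v v<u

≤lex-antisym : ∀ {u v} → u ≤lex v → v ≤lex u → u ≡ v
≤lex-antisym (inj₁ u≡v) _          = u≡v
≤lex-antisym (inj₂ _)   (inj₁ v≡u) = sym v≡u
≤lex-antisym (inj₂ u<v) (inj₂ v<u) = ⊥-elim (lex-asym u<v v<u)

first-difference : ∀ {v y} → v <lex y → length v ≡ length y →
  ∃ λ q → ∃ λ t → ∃ λ s → v ≡ q ++ a ∷ t × y ≡ q ++ b ∷ s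
first-difference []<∷             ()
first-difference (a<b {xs} {ys})  _ = [] , xs , ys , refl , refl
first-difference (∷<∷ {x} v<y) e with first-difference v<y (suc-injective e)
... | q , t , s , refl , refl = x ∷ q , t , s , refl , refl

Obstruction : Word → Word → Set
Obstruction w u = Factor (a ∷ u ++ a ∷ []) w × Factor (b ∷ u ++ b ∷ []) w

count-b-snoc : ∀ u → count-b (u ++ b ∷ []) ≡ suc (count-b (u ++ a ∷ []))
count-b-snoc []      = refl
count-b-snoc (a ∷ u) = count-b-snoc u
count-b-snoc (b ∷ u) = cong suc (count-b-snoc u)

-- b·u·b and a·u·a have equal length and differ by two b's.
obstruction⇒unbalanced : ∀ {w u} → Obstruction w u → ¬ Balanced w
obstruction⇒unbalanced {u = u} (fa , fb) balanced =
  <-irrefl refl (subst (λ n → suc n ≤ suc (count-b (u ++ a ∷ []))) (count-b-snoc u)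
    (balanced (b ∷ u ++ b ∷ []) (a ∷ u ++ a ∷ []) fb fa same-length))
  where
  same-length : length (b ∷ u ++ b ∷ []) ≡ length (a ∷ u ++ a ∷ [])
  same-length = cong suc (trans (length-++ u) (sym (length-++ u)))

factor-reassoc : ∀ x p c {r w} → Factor (x ∷ p ++ c ∷ r) w → Factor (x ∷ (p ++ c ∷ []) ++ r) w
factor-reassoc x p c {r} {w} = subst (λ z → Factor (x ∷ z) w) (sym (++-assoc p (c ∷ []) r))

imbalance⇒obstruction : ∀ {w} x y → Factor x w → Factor y w → length x ≡ length y →
  2 + count-b y ≤ count-b x → ∃ (Obstruction w)

-- Factors b·p·s and a·p·t, where s has more b's than t: extend the common part p
-- until the two words diverge.
diverging⇒obstruction : ∀ {w} p s t → Factor (b ∷ p ++ s) w → Factor (a ∷ p ++ t) w →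
  length s ≡ length t → suc (count-b t) ≤ count-b s → ∃ (Obstruction w)

imbalance⇒obstruction []      _       _  _  _ ()
imbalance⇒obstruction (_ ∷ _) []      _  _  () _
imbalance⇒obstruction (a ∷ x) (a ∷ y) fx fy e d =
  imbalance⇒obstruction x y (suffix-factor (a ∷ []) fx) (suffix-factor (a ∷ []) fy) (suc-injective e) d
imbalance⇒obstruction (b ∷ x) (b ∷ y) fx fy e (s≤s d) =
  imbalance⇒obstruction x y (suffix-factor (b ∷ []) fx) (suffix-factor (b ∷ []) fy) (suc-injective e) d
imbalance⇒obstruction (a ∷ x) (b ∷ y) fx fy e d =
  imbalance⇒obstruction x y (suffix-factor (a ∷ []) fx) (suffix-factor (b ∷ []) fy) (suc-injective e) (<⇒≤ d)
imbalance⇒obstruction (b ∷ x) (a ∷ y) fx fy e (s≤s d) =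
  diverging⇒obstruction [] x y fx fy (suc-injective e) d

diverging⇒obstruction p []      _       _  _  _ ()
diverging⇒obstruction p (_ ∷ _) []      _  _  () _
diverging⇒obstruction p (a ∷ s) (a ∷ t) fs ft e d =
  diverging⇒obstruction (p ++ a ∷ []) s t (factor-reassoc b p a fs) (factor-reassoc a p a ft) (suc-injective e) d
diverging⇒obstruction p (b ∷ s) (b ∷ t) fs ft e (s≤s d) =
  diverging⇒obstruction (p ++ b ∷ []) s t (factor-reassoc b p b fs) (factor-reassoc a p b ft) (suc-injective e) d
diverging⇒obstruction p (b ∷ s) (a ∷ t) fs ft _ _ =
  p , prefix-factor (marked-prefix a p a t) ft , prefix-factor (marked-prefix b p b s) fs
diverging⇒obstruction p (a ∷ s) (b ∷ t) fs ft e d =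
  imbalance⇒obstruction s t (suffix-factor (a ∷ []) (suffix-factor (b ∷ p) fs))
    (suffix-factor (b ∷ []) (suffix-factor (a ∷ p) ft)) (suc-injective e) d

obstruction-free⇒balanced : ∀ {w} → (∀ u → ¬ Obstruction w u) → Balanced w
obstruction-free⇒balanced free u v fu fv e with count-b u ≤? suc (count-b v)
... | yes ok = ok
... | no ¬ok with imbalance⇒obstruction u v fu fv e (≰⇒> ¬ok)
...   | q , obstruction = ⊥-elim (free q obstruction)

below-aua⇒shorter : ∀ {w u y v} → Factor (b ∷ u ++ b ∷ []) w → Prefix y (a ∷ u ++ a ∷ []) →
  Factor v w → length v ≡ length y → v <lex y → ∃ λ q → length q < length u × Obstruction w q
below-aua⇒shorter {u = u} fb (r , py) fv e v<y with first-difference v<y e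
below-aua⇒shorter {u = u} fb (r , ()) fv e v<y | [] , _ , _ , refl , refl
below-aua⇒shorter {u = u} fb (r , py) fv e v<y | _ ∷ q , t , s , refl , refl with ∷-injective py
... | refl , py′ with split-before-last q u (λ ()) (trans (sym (++-assoc q (b ∷ s) r)) py′)
...   | s' , refl =
  q , marked-shorter q b s' ,
  prefix-factor (marked-prefix a q a t) fv , prefix-factor (prefix-++ʳ (b ∷ []) (marked-prefix b q b s')) fb

above-bub⇒shorter : ∀ {w u y v} → Factor (a ∷ u ++ a ∷ []) w → Prefix y (b ∷ u ++ b ∷ []) →
  Factor v w → length y ≡ length v → y <lex v → ∃ λ q → length q < length u × Obstruction w q
above-bub⇒shorter {u = u} fa (r , py) fv e y<v with first-difference y<v e
above-bub⇒shorter {u = u} fa (r , ()) fv e y<v | [] , _ , _ , refl , refl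
above-bub⇒shorter {u = u} fa (r , py) fv e y<v | _ ∷ q , s , t , refl , refl with ∷-injective py
... | refl , py′ with split-before-last q u (λ ()) (trans (sym (++-assoc q (a ∷ s) r)) py′)
...   | s' , refl =
  q , marked-shorter q a s' ,
  prefix-factor (prefix-++ʳ (a ∷ []) (marked-prefix a q a s')) fa , prefix-factor (marked-prefix b q b t) fv

PrefixwiseMin : Word → Word → Set
PrefixwiseMin w m = ∀ y v → Prefix y m → Factor v w → length v ≡ length y → y ≤lex v

PrefixwiseMax : Word → Word → Set
PrefixwiseMax w m = ∀ y v → Prefix y m → Factor v w → length v ≡ length y → v ≤lex y

ShorterObstructionFree : Word → Word → Set
ShorterObstructionFree w u = ∀ q → length q < length u → ¬ Obstruction w q

aua-prefixwise-min : ∀ {w u} → Obstruction w u → ShorterObstructionFree w u →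
  PrefixwiseMin w (a ∷ u ++ a ∷ [])
aua-prefixwise-min (_ , fb) minimal y v py fv e with lex-trichotomy y v (sym e)
... | inj₁ y≡v        = inj₁ y≡v
... | inj₂ (inj₁ y<v) = inj₂ y<v
... | inj₂ (inj₂ v<y) with below-aua⇒shorter fb py fv e v<y
...   | q , shorter , obstruction = ⊥-elim (minimal q shorter obstruction)

bub-prefixwise-max : ∀ {w u} → Obstruction w u → ShorterObstructionFree w u →
  PrefixwiseMax w (b ∷ u ++ b ∷ [])
bub-prefixwise-max (fa , _) minimal y v py fv e with lex-trichotomy v y e
... | inj₁ v≡y        = inj₁ v≡y
... | inj₂ (inj₁ v<y) = inj₂ v<y
... | inj₂ (inj₂ y<v) with above-bub⇒shorter fa py fv (sym e) y<v
...   | q , shorter , obstruction = ⊥-elim (minimal q shorter obstruction)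

prefixwise-min⇒chain : ∀ {w m} → Factor m w → PrefixwiseMin w m → MinChain w (length m) m
prefixwise-min⇒chain {w} {m} fm least = factor-length fm , least-of-length , chain
  where
  least-of-length : IsMinK w (length m) m
  least-of-length = fm , refl , λ v fv e → least m v ([] , ++-identityʳ m) fv e
  chain : ∀ j m' → 1 ≤ j → j ≤ length m → IsMinK w j m' → Prefix m' m
  chain j m' _ j≤ (fm' , e' , least') with prefix-of-length j m j≤
  ... | y , py , e =
    subst (λ z → Prefix z m)
      (≤lex-antisym (least y m' py fm' (trans e' (sym e))) (least' y (prefix-factor py fm) e)) py

prefixwise-max⇒chain : ∀ {w m} → Factor m w → PrefixwiseMax w m → MaxChain w (length m) m
prefixwise-max⇒chain {w} {m} fm greatest = factor-length fm , greatest-of-length , chain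
  where
  greatest-of-length : IsMaxK w (length m) m
  greatest-of-length = fm , refl , λ v fv e → greatest m v ([] , ++-identityʳ m) fv e
  chain : ∀ j m' → 1 ≤ j → j ≤ length m → IsMaxK w j m' → Prefix m' m
  chain j m' _ j≤ (fm' , e' , greatest') with prefix-of-length j m j≤
  ... | y , py , e =
    subst (λ z → Prefix z m)
      (≤lex-antisym (greatest' y (prefix-factor py fm) e) (greatest y m' py fm' (trans e' (sym e)))) py

-- By maximality of the chain defining min(w), every nonempty chain word is a prefix of it.
chain⇒prefix-of-min : ∀ {w mn k m} → IsMin w mn → MinChain w k m → 1 ≤ k → Prefix m mn
chain⇒prefix-of-min {k = k} {m} (k₀ , (_ , _ , prefixes) , maximal) ch@(_ , least , _) 1≤k
  with k₀ <? k
... | yes k₀<k = ⊥-elim (maximal k m k₀<k ch)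
... | no k₀≮k  = prefixes k m 1≤k (≮⇒≥ k₀≮k) least

chain⇒prefix-of-max : ∀ {w mx k m} → IsMax w mx → MaxChain w k m → 1 ≤ k → Prefix m mx
chain⇒prefix-of-max {k = k} {m} (k₀ , (_ , _ , prefixes) , maximal) ch@(_ , greatest , _) 1≤k
  with k₀ <? k
... | yes k₀<k = ⊥-elim (maximal k m k₀<k ch)
... | no k₀≮k  = prefixes k m 1≤k (≮⇒≥ k₀≮k) greatest

Witness : Word → Word → Set
Witness mn mx = ∃ λ u → Prefix (a ∷ u ++ a ∷ []) mn × Prefix (b ∷ u ++ b ∷ []) mx

minimal-obstruction⇒witness : ∀ {w mn mx u} → IsMin w mn → IsMax w mx →
  Obstruction w u → ShorterObstructionFree w u → Witness mn mx
minimal-obstruction⇒witness {u = u} hmn hmx ob@(fa , fb) minimal =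
  u , chain⇒prefix-of-min hmn (prefixwise-min⇒chain fa (aua-prefixwise-min ob minimal)) (s≤s z≤n)
    , chain⇒prefix-of-max hmx (prefixwise-max⇒chain fb (bub-prefixwise-max ob minimal)) (s≤s z≤n)

no-witness⇒obstruction-free : ∀ {w mn mx} → IsMin w mn → IsMax w mx → ¬ Witness mn mx →
  ∀ u → ¬ Obstruction w u
no-witness⇒obstruction-free {w} hmn hmx ¬witness u = go u (On.wellFounded length <-wellFounded u)
  where
  go : ∀ u → Acc (_<_ on length) u → ¬ Obstruction w u
  go u (acc shorter) ob =
    ¬witness (minimal-obstruction⇒witness hmn hmx ob (λ q q<u → go q (shorter q<u)))

Fork : Word → Word → Set
Fork s t = ∃ λ u → Prefix (u ++ a ∷ []) s × Prefix (u ++ b ∷ []) t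

fork-cons : ∀ x {s t} → Fork s t → Fork (x ∷ s) (x ∷ t)
fork-cons x (u , (r , e₁) , (r' , e₂)) = x ∷ u , (r , cong (x ∷_) e₁) , (r' , cong (x ∷_) e₂)

fork-tail : ∀ {x s t} → Fork (x ∷ s) (x ∷ t) → Fork s t
fork-tail ([] , (_ , refl) , (_ , ()))
fork-tail ((_ ∷ u) , (r , e₁) , (r' , e₂)) = u , (r , ∷-injectiveʳ e₁) , (r' , ∷-injectiveʳ e₂)

fork? : ∀ s t → Dec (Fork s t)
fork? []      _       = no λ { ([] , (_ , ()) , _) ; ((_ ∷ _) , (_ , ()) , _) }
fork? (_ ∷ _) []      = no λ { ([] , _ , (_ , ())) ; ((_ ∷ _) , _ , (_ , ())) }
fork? (a ∷ s) (b ∷ t) = yes ([] , (s , refl) , (t , refl))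
fork? (b ∷ _) (a ∷ _) = no λ { ([] , (_ , ()) , _) ; ((_ ∷ _) , (_ , refl) , (_ , ())) }
fork? (a ∷ s) (a ∷ t) = map′ (fork-cons a) fork-tail (fork? s t)
fork? (b ∷ s) (b ∷ t) = map′ (fork-cons b) fork-tail (fork? s t)

witness? : ∀ mn mx → Dec (Witness mn mx)
witness? []      _       = no λ { (_ , (_ , ()) , _) }
witness? (b ∷ _) _       = no λ { (_ , (_ , ()) , _) }
witness? (a ∷ _) []      = no λ { (_ , _ , (_ , ())) }
witness? (a ∷ _) (a ∷ _) = no λ { (_ , _ , (_ , ())) }
witness? (a ∷ s) (b ∷ t) = map′ from-fork to-fork (fork? s t)
  where
  from-fork : Fork s t → Witness (a ∷ s) (b ∷ t)
  from-fork (u , (r , e₁) , (r' , e₂)) = u , (r , cong (a ∷_) e₁) , (r' , cong (b ∷_) e₂)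
  to-fork : Witness (a ∷ s) (b ∷ t) → Fork s t
  to-fork (u , (r , e₁) , (r' , e₂)) = u , (r , ∷-injectiveʳ e₁) , (r' , ∷-injectiveʳ e₂)

min-factor : ∀ {w m} → IsMin w m → Factor m w
min-factor (_ , (_ , (fm , _) , _) , _) = fm

max-factor : ∀ {w m} → IsMax w m → Factor m w
max-factor (_ , (_ , (fm , _) , _) , _) = fm

corollary4p9 : (w : Word) → ¬ (w ≡ []) → (mn mx : Word) → IsMin w mn → IsMax w mx →
    (¬ Balanced w) ⇔ (∃ λ u → Prefix (a ∷ u ++ a ∷ []) mn × Prefix (b ∷ u ++ b ∷ []) mx)
corollary4p9 w _ mn mx hmn hmx = mk⇔ unbalanced⇒witness witness⇒unbalanced
  where
  witness⇒unbalanced : Witness mn mx → ¬ Balanced w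
  witness⇒unbalanced (u , pa , pb) =
    obstruction⇒unbalanced (prefix-factor pa (min-factor hmn) , prefix-factor pb (max-factor hmx))
  unbalanced⇒witness : ¬ Balanced w → Witness mn mx
  unbalanced⇒witness unbalanced with witness? mn mx
  ... | yes witness = witness
  ... | no ¬witness =
    ⊥-elim (unbalanced (obstruction-free⇒balanced (no-witness⇒obstruction-free hmn hmx ¬witness)))
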